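{- Let $G$ be a graph with an even number $n\geq 2$ of vertices, and let $\overline{G}$ be its complement. If $\mathrm{mp}(G)\cdot\mathrm{mp}(\overline{G})=\lceil\frac{n-1}{2}\rceil\lfloor\frac{n-1}{2}\rfloor$, then $G$ is $\lceil\frac{n-1}{2}\rceil$-regular or $\lfloor\frac{n-1}{2}\rfloor$-regular.
   Context: All graphs are finite, simple and undirected; $\overline{G}$ is the complement of $G$. A perfect matching is a set of edges covering every vertex exactly once; an almost-perfect matching is a set of edges covering every vertex except one exactly once and missing the remaining vertex. The matching preclusion number $\mathrm{mp}(G)$ is the minimum number of edges whose deletion leaves a graph with neither a perfect matching nor an almost-perfect matching ($\mathrm{mp}(G)=0$ if $G$ has neither). -}

module Defs where

open import Data.Nat using (ℕ; zero; suc; _+_; _*_; _<_; _∸_; _/_)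
open import Data.Bool using (Bool; true; false; not; _∧_; T)
open import Data.Fin using (Fin; toℕ)
open import Data.List using (List; sum; map; length; filter)
open import Data.List using () renaming (allFin to allFinL)
open import Data.Product using (Σ; _×_; _,_; ∃)
open import Data.Sum using (_⊎_)
open import Relation.Binary.PropositionalEquality using (_≡_)
open import Relation.Nullary using (¬_; does; yes; no)
open import Relation.Binary.PropositionalEquality using (refl; cong₂) renaming (sym to ≡sym)
open import Data.Fin using () renaming (_≟_ to _≟F_)
open import Data.Empty using (⊥-elim)
open import Data.Bool.Properties using (T?; ∧-zeroʳ)
open import Data.Product using (proj₁; proj₂)
open import Data.List using (concatMap)
open import Data.Nat using (_<?_)

record Graph (n : ℕ) : Set where
  field
    adj   : Fin n → Fin n → Bool
    sym   : ∀ u v → adj u v ≡ adj v u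
    irrefl : ∀ v → adj v v ≡ false
open Graph public

complement : ∀ {n} → Graph n → Graph n
complement {n} G = record
  { adj = λ u v → not (adj G u v) ∧ not (u ≡ᵇ v)
  ; sym = λ u v → symC u v
  ; irrefl = λ v → irrC v }
  where
    _≡ᵇ_ : Fin n → Fin n → Bool
    u ≡ᵇ v = does (u ≟F v)
    eqsym : ∀ u v → (u ≡ᵇ v) ≡ (v ≡ᵇ u)
    eqsym u v with u ≟F v | v ≟F u
    ... | yes _ | yes _ = refl
    ... | no _ | no _ = refl
    ... | yes p | no q = ⊥-elim (q (≡sym p))
    ... | no q | yes p = ⊥-elim (q (≡sym p))
    symC : ∀ u v → (not (adj G u v) ∧ not (u ≡ᵇ v)) ≡ (not (adj G v u) ∧ not (v ≡ᵇ u))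
    symC u v = cong₂ (λ a b → not a ∧ not b) (Graph.sym G u v) (eqsym u v)
    irrC : ∀ v → (not (adj G v v) ∧ not (v ≡ᵇ v)) ≡ false
    irrC v with v ≟F v
    ... | yes _ = ∧-zeroʳ _
    ... | no q = ⊥-elim (q refl)

_⊆G_ : ∀ {n} → Graph n → Graph n → Set
H ⊆G G = ∀ u v → T (adj H u v) → T (adj G u v)

-- Number of (unordered) edges of G, counted over pairs u < v.
countPairs : ∀ {n} → (Fin n → Fin n → Bool) → ℕ
countPairs {n} f =
  length (filter (λ p → T? (f (proj₁ p) (proj₂ p)))
    (concatMap (λ u → map (λ v → (u , v)) (filter (λ v → toℕ u <? toℕ v) (allFinL n))) (allFinL n)))

deleted : ∀ {n} → Graph n → Graph n → ℕ
deleted G H = countPairs (λ u v → adj G u v ∧ not (adj H u v))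

degree : ∀ {n} → Graph n → Fin n → ℕ
degree {n} G v = length (filter (λ u → T? (adj G v u)) (allFinL n))

PerfectMatching : ∀ {n} → Graph n → Set
PerfectMatching {n} H = Σ (Graph n) λ M → M ⊆G H × (∀ v → degree M v ≡ 1)

AlmostPerfectMatching : ∀ {n} → Graph n → Set
AlmostPerfectMatching {n} H =
  Σ (Graph n) λ M → M ⊆G H × Σ (Fin n) λ w →
    degree M w ≡ 0 × (∀ v → ¬ (v ≡ w) → degree M v ≡ 1)

HasMatching : ∀ {n} → Graph n → Set
HasMatching H = PerfectMatching H ⊎ AlmostPerfectMatching H

Precludes : ∀ {n} → Graph n → ℕ → Set
Precludes {n} G k = Σ (Graph n) λ H → H ⊆G G × deleted G H ≡ k × ¬ HasMatching H

-- mp(G) = k : k edges suffice, and no fewer do.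
-- (If G has no such matching, k = 0 since H = G works with 0 deletions.)
IsMP : ∀ {n} → Graph n → ℕ → Set
IsMP G k = Precludes G k × (∀ j → j < k → ¬ Precludes G j)

Regular : ∀ {n} → Graph n → ℕ → Set
Regular G k = ∀ v → degree G v ≡ k

⌈_/2⌉ ⌊_/2⌋ : ℕ → ℕ
⌈ m /2⌉ = (m + 1) / 2
⌊ m /2⌋ = m / 2

module Submission where

-- Write n = 2(k+1), so ⌈(n−1)/2⌉ = k+1 and ⌊(n−1)/2⌋ = k.
--  (1) For n even, mp(H) ≤ deg_H(v) for every vertex v: deleting the
--      deg v edges at v isolates v (no perfect matching) and, n being
--      even, no almost-perfect matching exists at all (handshake lemma).
--  (2) deg_G(v) + deg_Ḡ(v) = n − 1 = 2k + 1 for every vertex v.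
--  Hence (k+1)k ≤ deg_G(v) · deg_Ḡ(w) for all v, w.  Taking w = v, a sum
--  2k+1 with product at least (k+1)k forces deg_G(v) ∈ {k+1, k}; and if
--  two vertices had degrees k and k+1, taking v, w to be them gives
--  (k+1)k ≤ k·k, impossible for k ≥ 1.  The case n = 2 is immediate.

open import Defs hiding (sym)
open import Data.Nat using (ℕ; zero; suc; _+_; _*_; _∸_; _≤_; _<_; _/_; z≤n; s≤s; _<?_; NonZero)
open import Data.Nat.Properties
  using (+-identityʳ; +-comm; +-cancelˡ-≡; +-cancelʳ-≤; +-monoʳ-≤; +-mono-≤; *-comm; *-mono-≤;
         *-monoˡ-<; m<m+n; ≤-<-trans; <⇒≱; ≮⇒≥; <-cmp; suc-injective; 0≢1+n;
         m≤n⇒∃[o]m+o≡n; m<1+n⇒m<n∨m≡n; n<1+n; even≢odd; +-*-semiring; module ≤-Reasoning)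
open import Data.Nat.Divisibility using (_∣_; divides)
open import Data.Nat.DivMod using (m*n/n≡m; +-distrib-/-∣ʳ)
open import Data.Nat.Tactic.RingSolver using (solve-∀)
open import Data.Bool using (Bool; true; false; not; _∧_; T)
open import Data.Bool.Properties using (T?; T-∧; ∧-comm; ∧-zeroʳ)
open import Data.Fin using (Fin; zero; suc; toℕ; _≟_; punchIn)
open import Data.Fin.Properties using (toℕ-injective; punchInᵢ≢i)
open import Data.List using (List; length; filter; map; concatMap; tabulate)
open import Data.List.Properties using (filter-++; length-++)
open import Data.Product using (_×_; _,_; proj₁; proj₂)
open import Data.Sum using (_⊎_; inj₁; inj₂; [_,_]′)
open import Data.Empty using (⊥; ⊥-elim)
open import Data.Unit using (tt)
open import Function using (_∘_; id; Equivalence)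
open import Relation.Binary.Definitions using (tri<; tri≈; tri>)
open import Relation.Binary.PropositionalEquality
  using (_≡_; _≢_; refl; sym; trans; cong; cong₂; subst; subst₂; ≢-sym; module ≡-Reasoning)
open import Relation.Nullary using (¬_; does; yes; no)
open import Relation.Nullary.Decidable using (dec-true; dec-false)
open import Relation.Unary using (Pred; Decidable)
open import Algebra.Properties.Semiring.Sum +-*-semiring
  using (sum; sum-syntax; sum-cong-≗; sum-replicate-zero; sum-remove; ∑-distrib-+; ∑-comm;
         *-distribˡ-sum)

⟦_⟧ : Bool → ℕ
⟦ true ⟧  = 1
⟦ false ⟧ = 0

-- Boolean equality test on vertices (the one used by `complement`).
_≡ᵇ_ : ∀ {n} → Fin n → Fin n → Bool
u ≡ᵇ v = does (u ≟ v)

≡ᵇ-refl : ∀ {n} (v : Fin n) → v ≡ᵇ v ≡ true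
≡ᵇ-refl v = dec-true (v ≟ v) refl

≡ᵇ-≢ : ∀ {n} {u v : Fin n} → u ≢ v → v ≡ᵇ u ≡ false
≡ᵇ-≢ {u = u} {v} u≢v = dec-false (v ≟ u) (≢-sym u≢v)

∑-mono : ∀ {n} {f g : Fin n → ℕ} → (∀ i → f i ≤ g i) → ∑[ i < n ] f i ≤ ∑[ i < n ] g i
∑-mono {zero}  f≤g = z≤n
∑-mono {suc n} f≤g = +-mono-≤ (f≤g zero) (∑-mono (f≤g ∘ suc))

∑-vanishes : ∀ {n} (f : Fin n → ℕ) → (∀ i → f i ≡ 0) → ∑[ i < n ] f i ≡ 0
∑-vanishes {n} f f≡0 = trans (sum-cong-≗ f≡0) (sum-replicate-zero n)

∑-ones : ∀ n → ∑[ i < n ] 1 ≡ n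
∑-ones zero    = refl
∑-ones (suc n) = cong suc (∑-ones n)

∑-single : ∀ {n} (f : Fin n → ℕ) (v : Fin n) → (∀ i → i ≢ v → f i ≡ 0) → ∑[ i < n ] f i ≡ f v
∑-single {suc n} f v others = begin
  sum f                                ≡⟨ sum-remove {i = v} f ⟩
  f v + ∑[ i < n ] f (punchIn v i)     ≡⟨ cong (f v +_) (∑-vanishes _ (λ i → others _ (punchInᵢ≢i v i))) ⟩
  f v + 0                              ≡⟨ +-identityʳ (f v) ⟩
  f v                                  ∎
  where open ≡-Reasoning

∑-select : ∀ {n} (v : Fin n) (K : Fin n → ℕ) → ∑[ u < n ] (⟦ v ≡ᵇ u ⟧ * K u) ≡ K v
∑-select v K = trans (∑-single _ v (λ u u≢v → cong (λ b → ⟦ b ⟧ * K u) (≡ᵇ-≢ u≢v)))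
                     (trans (cong (λ b → ⟦ b ⟧ * K v) (≡ᵇ-refl v)) (+-identityʳ (K v)))

∑-all-ones-but-one : ∀ {n} (f : Fin n → ℕ) (w : Fin n) →
  f w ≡ 0 → (∀ i → i ≢ w → f i ≡ 1) → suc (∑[ i < n ] f i) ≡ n
∑-all-ones-but-one {suc n} f w fw≡0 others = cong suc (begin
  sum f                              ≡⟨ sum-remove {i = w} f ⟩
  f w + ∑[ i < n ] f (punchIn w i)   ≡⟨ cong₂ _+_ fw≡0 (sum-cong-≗ (λ i → others _ (punchInᵢ≢i w i))) ⟩
  ∑[ i < n ] 1                       ≡⟨ ∑-ones n ⟩
  n                                  ∎)
  where open ≡-Reasoning

length-filter-tabulate : ∀ {a} {A : Set a} {n} (p : A → Bool) (g : Fin n → A) →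
  length (filter (λ x → T? (p x)) (tabulate g)) ≡ ∑[ i < n ] ⟦ p (g i) ⟧
length-filter-tabulate {n = zero}  p g = refl
length-filter-tabulate {n = suc n} p g with p (g zero)
... | true  = cong suc (length-filter-tabulate p (g ∘ suc))
... | false = length-filter-tabulate p (g ∘ suc)

length-filter-concatMap : ∀ {a b p} {A : Set a} {B : Set b} {P : Pred B p} (P? : Decidable P)
  {n} (h : A → List B) (g : Fin n → A) →
  length (filter P? (concatMap h (tabulate g))) ≡ ∑[ i < n ] length (filter P? (h (g i)))
length-filter-concatMap P? {zero}  h g = refl
length-filter-concatMap {B = B} P? {suc n} h g =
  trans (cong length (filter-++ P? (h (g zero)) rest))
        (trans (length-++ (filter P? (h (g zero))))
               (cong (length (filter P? (h (g zero))) +_) (length-filter-concatMap P? h (g ∘ suc))))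
  where
  rest : List B
  rest = concatMap h (tabulate (g ∘ suc))

length-filter-map-filter : ∀ {a b r} {A : Set a} {B : Set b} {R : Pred A r} {n}
  (p : B → Bool) (k : A → B) (R? : Decidable R) (g : Fin n → A) →
  length (filter (λ x → T? (p x)) (map k (filter R? (tabulate g))))
    ≡ ∑[ i < n ] ⟦ does (R? (g i)) ∧ p (k (g i)) ⟧
length-filter-map-filter {n = zero}  p k R? g = refl
length-filter-map-filter {n = suc n} p k R? g with does (R? (g zero))
... | false = length-filter-map-filter p k R? (g ∘ suc)
... | true with p (k (g zero))
...   | true  = cong suc (length-filter-map-filter p k R? (g ∘ suc))
...   | false = length-filter-map-filter p k R? (g ∘ suc)

-- The order in which `countPairs` enumerates unordered pairs.
_⊏_ : ∀ {n} → Fin n → Fin n → Bool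
u ⊏ y = does (toℕ u <? toℕ y)

pairCount : ∀ {n} → (Fin n → Fin n → Bool) → ℕ
pairCount {n} f = ∑[ u < n ] ∑[ y < n ] ⟦ u ⊏ y ∧ f u y ⟧

countPairs≡pairCount : ∀ {n} (f : Fin n → Fin n → Bool) → countPairs f ≡ pairCount f
countPairs≡pairCount {n} f =
  trans (length-filter-concatMap P? block id)
        (sum-cong-≗ (λ u → length-filter-map-filter (λ q → f (proj₁ q) (proj₂ q)) (u ,_)
                                                     (λ y → toℕ u <? toℕ y) id))
  where
  P? : Decidable (λ (q : Fin n × Fin n) → T (f (proj₁ q) (proj₂ q)))
  P? q = T? (f (proj₁ q) (proj₂ q))
  block : Fin n → List (Fin n × Fin n)
  block u = map (u ,_) (filter (λ y → toℕ u <? toℕ y) (tabulate id))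

degree≡∑ : ∀ {n} (G : Graph n) (v : Fin n) → degree G v ≡ ∑[ y < n ] ⟦ adj G v y ⟧
degree≡∑ G v = length-filter-tabulate (adj G v) id

-- Two distinct vertices are ordered one way or the other, never both:
-- an irreflexive relation splits along ⊏.
⊏-split : ∀ {n} (u y : Fin n) (b : Bool) → (u ≡ y → b ≡ false) →
  ⟦ b ⟧ ≡ ⟦ u ⊏ y ∧ b ⟧ + ⟦ y ⊏ u ∧ b ⟧
⊏-split u y b irr with <-cmp (toℕ u) (toℕ y)
... | tri< u<y _ y≮u rewrite dec-true (toℕ u <? toℕ y) u<y | dec-false (toℕ y <? toℕ u) y≮u
    = sym (+-identityʳ ⟦ b ⟧)
... | tri> u≮y _ y<u rewrite dec-false (toℕ u <? toℕ y) u≮y | dec-true (toℕ y <? toℕ u) y<u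
    = refl
... | tri≈ _ u≡y _ rewrite irr (toℕ-injective u≡y) | ∧-zeroʳ (u ⊏ y) | ∧-zeroʳ (y ⊏ u)
    = refl

handshake : ∀ {n} (G : Graph n) → ∑[ v < n ] degree G v ≡ 2 * countPairs (adj G)
handshake {n} G = begin
  ∑[ u < n ] degree G u
    ≡⟨ sum-cong-≗ (degree≡∑ G) ⟩
  ∑[ u < n ] ∑[ y < n ] ⟦ A u y ⟧
    ≡⟨ sum-cong-≗ (λ u → sum-cong-≗ (λ y → ⊏-split u y (A u y) (λ { refl → Graph.irrefl G u }))) ⟩
  ∑[ u < n ] ∑[ y < n ] (F u y + B u y)
    ≡⟨ sum-cong-≗ (λ u → ∑-distrib-+ (F u) (B u)) ⟩
  ∑[ u < n ] (∑[ y < n ] F u y + ∑[ y < n ] B u y)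
    ≡⟨ ∑-distrib-+ (λ u → ∑[ y < n ] F u y) (λ u → ∑[ y < n ] B u y) ⟩
  pairCount A + ∑[ u < n ] ∑[ y < n ] B u y
    ≡⟨ cong (pairCount A +_) (∑-comm B) ⟩
  pairCount A + ∑[ y < n ] ∑[ u < n ] B u y
    ≡⟨ cong (pairCount A +_) (sum-cong-≗ (λ y → sum-cong-≗ (λ u →
         cong (λ b → ⟦ y ⊏ u ∧ b ⟧) (Graph.sym G u y)))) ⟩
  pairCount A + pairCount A
    ≡⟨ cong (pairCount A +_) (sym (+-identityʳ (pairCount A))) ⟩
  2 * pairCount A
    ≡⟨ cong (2 *_) (sym (countPairs≡pairCount A)) ⟩
  2 * countPairs A
    ∎
  where
  open ≡-Reasoning
  A : Fin n → Fin n → Bool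
  A = adj G
  F B : Fin n → Fin n → ℕ
  F u y = ⟦ u ⊏ y ∧ A u y ⟧
  B u y = ⟦ y ⊏ u ∧ A u y ⟧

-- On an even number of vertices there is no almost-perfect matching:
-- its degrees would add up to the odd number n − 1.
no-almost-perfect-matching : ∀ {n} → 2 ∣ n → (H : Graph n) → ¬ AlmostPerfectMatching H
no-almost-perfect-matching {n} (divides q n≡q*2) H (M , _ , w , deg-w≡0 , deg-others≡1) =
  even≢odd q (countPairs (adj M)) (begin
    2 * q                                 ≡⟨ *-comm 2 q ⟩
    q * 2                                 ≡⟨ sym n≡q*2 ⟩
    n                                     ≡⟨ sym (∑-all-ones-but-one (degree M) w deg-w≡0 deg-others≡1) ⟩
    suc (∑[ v < n ] degree M v)           ≡⟨ cong suc (handshake M) ⟩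
    suc (2 * countPairs (adj M))          ∎)
  where open ≡-Reasoning

isolate : ∀ {n} → Graph n → Fin n → Graph n
isolate G v = record
  { adj    = λ x y → adj G x y ∧ (not (v ≡ᵇ x) ∧ not (v ≡ᵇ y))
  ; sym    = λ x y → cong₂ _∧_ (Graph.sym G x y) (∧-comm (not (v ≡ᵇ x)) (not (v ≡ᵇ y)))
  ; irrefl = λ x → cong (_∧ (not (v ≡ᵇ x) ∧ not (v ≡ᵇ x))) (Graph.irrefl G x)
  }

isolate⊆ : ∀ {n} (G : Graph n) (v : Fin n) → isolate G v ⊆G G
isolate⊆ G v x y = proj₁ ∘ Equivalence.to T-∧

isolated-degree : ∀ {n} (G M : Graph n) (v : Fin n) → M ⊆G isolate G v → degree M v ≡ 0
isolated-degree G M v M⊆ = trans (degree≡∑ M v) (∑-vanishes _ no-edge)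
  where
  no-edge : ∀ y → ⟦ adj M v y ⟧ ≡ 0
  no-edge y with adj M v y in edge
  ... | false = refl
  ... | true  = ⊥-elim (subst (λ b → T (not b)) (≡ᵇ-refl v) v-not-isolated)
    where
    in-G : T (adj G v y ∧ (not (v ≡ᵇ v) ∧ not (v ≡ᵇ y)))
    in-G = M⊆ v y (subst T (sym edge) tt)
    v-not-isolated : T (not (v ≡ᵇ v))
    v-not-isolated = proj₁ (Equivalence.to T-∧ (proj₂ (Equivalence.to (T-∧ {adj G v y}) in-G)))

isolate-precludes : ∀ {n} → 2 ∣ n → (G : Graph n) (v : Fin n) →
  Precludes G (deleted G (isolate G v))
isolate-precludes ev G v = isolate G v , isolate⊆ G v , refl , no-matching
  where
  no-matching : ¬ HasMatching (isolate G v)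
  no-matching (inj₁ (M , M⊆ , deg≡1)) = 0≢1+n (trans (sym (isolated-degree G M v M⊆)) (deg≡1 v))
  no-matching (inj₂ apm)              = no-almost-perfect-matching ev (isolate G v) apm

-- Truth table: an edge deleted by isolating v has an endpoint equal to v.
deleted-edge-at-v : ∀ l a e₁ e₂ →
  ⟦ l ∧ (a ∧ not (a ∧ (not e₁ ∧ not e₂))) ⟧ ≤ ⟦ e₁ ⟧ * ⟦ l ∧ a ⟧ + ⟦ e₂ ⟧ * ⟦ l ∧ a ⟧
deleted-edge-at-v false a     e₁    e₂    = z≤n
deleted-edge-at-v true  false e₁    e₂    = z≤n
deleted-edge-at-v true  true  true  e₂    = s≤s z≤n
deleted-edge-at-v true  true  false true  = s≤s z≤n
deleted-edge-at-v true  true  false false = z≤n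

deleted-by-isolation : ∀ {n} (G : Graph n) (v : Fin n) → deleted G (isolate G v) ≤ degree G v
deleted-by-isolation {n} G v = begin
  deleted G (isolate G v)
    ≡⟨ countPairs≡pairCount (λ u y → A u y ∧ not (adj (isolate G v) u y)) ⟩
  pairCount (λ u y → A u y ∧ not (adj (isolate G v) u y))
    ≤⟨ ∑-mono (λ u → ∑-mono (λ y → deleted-edge-at-v (u ⊏ y) (A u y) (v ≡ᵇ u) (v ≡ᵇ y))) ⟩
  ∑[ u < n ] ∑[ y < n ] (D u y + E u y)
    ≡⟨ trans (sum-cong-≗ (λ u → ∑-distrib-+ (D u) (E u)))
             (∑-distrib-+ (λ u → ∑[ y < n ] D u y) (λ u → ∑[ y < n ] E u y)) ⟩
  ∑[ u < n ] ∑[ y < n ] D u y + ∑[ u < n ] ∑[ y < n ] E u y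
    ≡⟨ cong₂ _+_ (trans (sum-cong-≗ (λ u → sym (*-distribˡ-sum ⟦ v ≡ᵇ u ⟧ (X u))))
                        (∑-select v (λ u → ∑[ y < n ] X u y)))
                 (sum-cong-≗ (λ u → ∑-select v (X u))) ⟩
  ∑[ y < n ] X v y + ∑[ y < n ] X y v
    ≡⟨ cong (∑[ y < n ] X v y +_) (sum-cong-≗ (λ y → cong (λ b → ⟦ y ⊏ v ∧ b ⟧) (Graph.sym G y v))) ⟩
  ∑[ y < n ] ⟦ v ⊏ y ∧ A v y ⟧ + ∑[ y < n ] ⟦ y ⊏ v ∧ A v y ⟧
    ≡⟨ sym (∑-distrib-+ (X v) (λ y → ⟦ y ⊏ v ∧ A v y ⟧)) ⟩
  ∑[ y < n ] (⟦ v ⊏ y ∧ A v y ⟧ + ⟦ y ⊏ v ∧ A v y ⟧)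
    ≡⟨ sum-cong-≗ (λ y → sym (⊏-split v y (A v y) (λ { refl → Graph.irrefl G v }))) ⟩
  ∑[ y < n ] ⟦ A v y ⟧
    ≡⟨ sym (degree≡∑ G v) ⟩
  degree G v
    ∎
  where
  open ≤-Reasoning
  A : Fin n → Fin n → Bool
  A = adj G
  X D E : Fin n → Fin n → ℕ
  X u y = ⟦ u ⊏ y ∧ A u y ⟧
  D u y = ⟦ v ≡ᵇ u ⟧ * X u y
  E u y = ⟦ v ≡ᵇ y ⟧ * X u y

mp≤degree : ∀ {n} → 2 ∣ n → (G : Graph n) (a : ℕ) → IsMP G a → ∀ v → a ≤ degree G v
mp≤degree ev G a (_ , minimal) v = ≮⇒≥ (λ deg<a →
  minimal _ (≤-<-trans (deleted-by-isolation G v) deg<a) (isolate-precludes ev G v))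

neighbour-once : ∀ {n} (G : Graph n) (v y : Fin n) →
  ⟦ adj G v y ⟧ + ⟦ adj (complement G) v y ⟧ + ⟦ v ≡ᵇ y ⟧ ≡ 1
neighbour-once G v y with v ≟ y
... | yes refl rewrite Graph.irrefl G v = refl
... | no _ with adj G v y
...   | true  = refl
...   | false = refl

complement-degree : ∀ {n} (G : Graph n) (v : Fin n) →
  degree G v + degree (complement G) v + 1 ≡ n
complement-degree {n} G v = begin
  degree G v + degree (complement G) v + 1
    ≡⟨ cong₂ (λ d e → d + e + 1) (degree≡∑ G v) (degree≡∑ (complement G) v) ⟩
  ∑[ y < n ] P y + ∑[ y < n ] Q y + 1
    ≡⟨ cong (∑[ y < n ] P y + ∑[ y < n ] Q y +_) (sym v-counted-once) ⟩
  ∑[ y < n ] P y + ∑[ y < n ] Q y + ∑[ y < n ] R y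
    ≡⟨ cong (_+ ∑[ y < n ] R y) (sym (∑-distrib-+ P Q)) ⟩
  ∑[ y < n ] (P y + Q y) + ∑[ y < n ] R y
    ≡⟨ sym (∑-distrib-+ (λ y → P y + Q y) R) ⟩
  ∑[ y < n ] (P y + Q y + R y)
    ≡⟨ sum-cong-≗ (neighbour-once G v) ⟩
  ∑[ y < n ] 1
    ≡⟨ ∑-ones n ⟩
  n ∎
  where
  open ≡-Reasoning
  P Q R : Fin n → ℕ
  P y = ⟦ adj G v y ⟧
  Q y = ⟦ adj (complement G) v y ⟧
  R y = ⟦ v ≡ᵇ y ⟧
  v-counted-once : ∑[ y < n ] R y ≡ 1
  v-counted-once = trans (∑-single R v (λ y y≢v → cong ⟦_⟧ (≡ᵇ-≢ y≢v))) (cong ⟦_⟧ (≡ᵇ-refl v))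

half-up : ∀ k → ⌈ suc k * 2 ∸ 1 /2⌉ ≡ suc k
half-up k = trans (cong (_/ 2) (+-comm (suc (k * 2)) 1)) (m*n/n≡m (suc k) 2)

half-down : ∀ k → ⌊ suc k * 2 ∸ 1 /2⌋ ≡ k
half-down k = trans (+-distrib-/-∣ʳ 1 {k * 2} (divides k refl)) (m*n/n≡m k 2)

double : ∀ k → suc k * 2 ≡ suc k + suc k
double = solve-∀

-- Writing d = k + 2 + r, the equation d + e = 2k + 1 says k = r + e + 1.
excess-split : ∀ k r e → suc (suc k) + r + e + 1 ≡ suc k * 2 → suc (r + e) ≡ k
excess-split k r e sum≡ =
  suc-injective (+-cancelˡ-≡ (suc k) _ _ (trans (sym (regroup k r e)) (trans sum≡ (double k))))
  where
  regroup : ∀ k r e → suc (suc k) + r + e + 1 ≡ suc k + suc (suc (r + e))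
  regroup = solve-∀

-- (k + 1) · k − d · e = (r + 1)(r + 2) > 0 in those coordinates.
lopsided-core : ∀ r e → (suc (suc (suc (r + e))) + r) * e < suc (suc (r + e)) * suc (r + e)
lopsided-core r e = subst ((suc (suc (suc (r + e))) + r) * e <_) (sym (expand r e)) (m<m+n _ (s≤s z≤n))
  where
  expand : ∀ r e → suc (suc (r + e)) * suc (r + e)
                    ≡ (suc (suc (suc (r + e))) + r) * e + suc (r * r + 3 * r + 1)
  expand = solve-∀

lopsided-product : ∀ k d e → d + e + 1 ≡ suc k * 2 → suc (suc k) ≤ d → d * e < suc k * k
lopsided-product k d e sum≡ k+2≤d with m≤n⇒∃[o]m+o≡n k+2≤d
... | r , refl with excess-split k r e sum≡
... | refl = lopsided-core r e

other-part-large : ∀ k d e → d + e + 1 ≡ suc k * 2 → d < k → suc (suc k) ≤ e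
other-part-large k d e sum≡ d<k = +-cancelʳ-≤ k (suc (suc k)) e (begin
  suc (suc k) + k   ≡⟨ sym (twice-shifted k) ⟩
  suc k * 2         ≡⟨ sym sum≡ ⟩
  d + e + 1         ≡⟨ shuffle d e ⟩
  e + suc d         ≤⟨ +-monoʳ-≤ e d<k ⟩
  e + k             ∎)
  where
  open ≤-Reasoning
  twice-shifted : ∀ k → suc k * 2 ≡ suc (suc k) + k
  twice-shifted = solve-∀
  shuffle : ∀ d e → d + e + 1 ≡ e + suc d
  shuffle = solve-∀

balanced-split : ∀ k d e → d + e + 1 ≡ suc k * 2 → suc k * k ≤ d * e → d ≡ suc k ⊎ d ≡ k
balanced-split k d e sum≡ bound with <-cmp d (suc k)
... | tri≈ _ d≡k+1 _ = inj₁ d≡k+1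
... | tri> _ _ k+1<d = ⊥-elim (<⇒≱ (lopsided-product k d e sum≡ k+1<d) bound)
... | tri< d<k+1 _ _ with m<1+n⇒m<n∨m≡n d<k+1
...   | inj₂ d≡k = inj₂ d≡k
...   | inj₁ d<k = ⊥-elim (<⇒≱ (lopsided-product k e d sum≡′ (other-part-large k d e sum≡ d<k))
                               (subst (suc k * k ≤_) (*-comm d e) bound))
  where
  sum≡′ : e + d + 1 ≡ suc k * 2
  sum≡′ = trans (cong (_+ 1) (+-comm e d)) sum≡

partner-of-larger : ∀ k e → suc k + e + 1 ≡ suc k * 2 → e ≡ k
partner-of-larger k e sum≡ =
  suc-injective (+-cancelˡ-≡ (suc k) _ _ (trans (shift k e) (trans sum≡ (double k))))
  where
  shift : ∀ k e → suc k + suc e ≡ suc k + e + 1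
  shift = solve-∀

near-regular : ∀ k .{{_ : NonZero k}} (G : Graph (suc k * 2)) →
  (∀ v w → suc k * k ≤ degree G v * degree (complement G) w) →
  Regular G (suc k) ⊎ Regular G k
near-regular k G bound = [ all-larger , all-smaller ]′ (two-values zero)
  where
  -- w = v: each degree is k + 1 or k.
  two-values : ∀ v → degree G v ≡ suc k ⊎ degree G v ≡ k
  two-values v = balanced-split k _ _ (complement-degree G v) (bound v v)
  -- Degrees k at v and k + 1 at w would give (k + 1) · k ≤ k · k.
  mixed : ∀ v w → degree G v ≡ k → degree G w ≡ suc k → ⊥
  mixed v w dv≡k dw≡k+1 = <⇒≱ (*-monoˡ-< k (n<1+n k))
    (subst (suc k * k ≤_) (cong₂ _*_ dv≡k (partner-of-larger k _ complement-sum)) (bound v w))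
    where
    complement-sum : suc k + degree (complement G) w + 1 ≡ suc k * 2
    complement-sum = subst (λ d → d + degree (complement G) w + 1 ≡ suc k * 2) dw≡k+1
                           (complement-degree G w)
  all-larger : degree G zero ≡ suc k → Regular G (suc k) ⊎ Regular G k
  all-larger d0 = inj₁ (λ w → [ id , (λ dw → ⊥-elim (mixed w zero dw d0)) ]′ (two-values w))
  all-smaller : degree G zero ≡ k → Regular G (suc k) ⊎ Regular G k
  all-smaller d0 = inj₂ (λ w → [ (λ dw → ⊥-elim (mixed zero w d0 dw)) , id ]′ (two-values w))

two-vertex-degree : (G : Graph 2) → Regular G ⟦ adj G zero (suc zero) ⟧
two-vertex-degree G zero = trans (degree≡∑ G zero)
  (trans (cong (λ b → ⟦ b ⟧ + (⟦ adj G zero (suc zero) ⟧ + 0)) (Graph.irrefl G zero))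
         (+-identityʳ _))
two-vertex-degree G (suc zero) = trans (degree≡∑ G (suc zero))
  (trans (cong₂ (λ a b → ⟦ a ⟧ + (⟦ b ⟧ + 0)) (Graph.sym G (suc zero) zero) (Graph.irrefl G (suc zero)))
         (+-identityʳ _))

-- Theorem 5.8 for n = 2, where ⌈1/2⌉ = 1 and ⌊1/2⌋ = 0: every graph qualifies.
two-vertex-regular : (G : Graph 2) → Regular G 1 ⊎ Regular G 0
two-vertex-regular G with adj G zero (suc zero) | two-vertex-degree G
... | true  | regular = inj₁ regular
... | false | regular = inj₂ regular

theorem5p8 : (n : ℕ) → 2 ≤ n → 2 ∣ n → (G : Graph n) → (a b : ℕ) →
    IsMP G a → IsMP (complement G) b →
    a * b ≡ ⌈ n ∸ 1 /2⌉ * ⌊ n ∸ 1 /2⌋ →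
    Regular G ⌈ n ∸ 1 /2⌉ ⊎ Regular G ⌊ n ∸ 1 /2⌋
theorem5p8 _ ()  (divides zero refl) _ _ _ _ _ _
theorem5p8 _ _   (divides 1 refl)    G _ _ _ _ _ = two-vertex-regular G
theorem5p8 _ _ ev@(divides (suc k@(suc _)) refl) G a b mpG mpḠ a*b≡ =
  subst₂ (λ c f → Regular G c ⊎ Regular G f) (sym (half-up k)) (sym (half-down k))
         (near-regular k G bound)
  where
  -- mp(G) ≤ deg_G(v) and mp(Ḡ) ≤ deg_Ḡ(w), so (k + 1) · k = mp(G) · mp(Ḡ) ≤ deg_G(v) · deg_Ḡ(w).
  bound : ∀ v w → suc k * k ≤ degree G v * degree (complement G) w
  bound v w = subst (_≤ degree G v * degree (complement G) w)
                    (trans a*b≡ (cong₂ _*_ (half-up k) (half-down k)))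
                    (*-mono-≤ (mp≤degree ev G a mpG v) (mp≤degree ev (complement G) b mpḠ w))
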